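{- Let $\mu=(\mathrm{Val},(\mathcal P,\mathcal O),\varsigma)$ be a model for the predicate symbols $\mathrm{broadcast},\mathrm{echo},\mathrm{ready},\mathrm{deliver}$ whose semitopology $(\mathcal P,\mathcal O)$ is 3-twined, and suppose every axiom of $\mathrm{ThyBB}$ is valid in $\mu$. Then for every $v\in\mathrm{Val}$, $$\models\mathsf{Somewhere}\,\mathrm{deliver}(v)\to_w\mathsf{Everywhere}\,\mathrm{deliver}(v).$$
   Context: Truth values: $\mathbf 3=\{\mathbf f,\mathbf b,\mathbf t\}$ totally ordered by $\mathbf f<\mathbf b<\mathbf t$; $\wedge,\vee$ are min and max, $\bigwedge,\bigvee$ are infimum and supremum. Negation: $\neg\mathbf t=\mathbf f$, $\neg\mathbf b=\mathbf b$, $\neg\mathbf f=\mathbf t$. Modalities: $\mathsf T x=\mathbf t$ if $x=\mathbf t$, else $\mathbf f$; $\mathsf B x=\mathbf t$ if $x=\mathbf b$, else $\mathbf f$; $\mathsf{TF}x=\mathbf t$ if $x\in\{\mathbf t,\mathbf f\}$, else $\mathbf f$. Weak implication: $x\to_w y:=\neg x\vee y$. A truth value is valid iff it lies in $\{\mathbf t,\mathbf b\}$. A semitopology $(\mathcal P,\mathcal O)$ is a set $\mathcal P$ with a family $\mathcal O$ of subsets containing $\mathcal P$ and closed under arbitrary (including empty) unions; $\mathcal O^{\neq\emptyset}$ is the set of nonempty members of $\mathcal O$. It is 3-twined if any three members of $\mathcal O^{\neq\emptyset}$ have nonempty intersection. For $f:\mathcal P\to\mathbf 3$: $\mathsf{Everywhere}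 f=\bigwedge_{p}f(p)$, $\mathsf{Somewhere} f=\bigvee_p f(p)$, $\mathsf{Quorum} f=\bigvee_{O\in\mathcal O^{\neq\emptyset}}\bigwedge_{p\in O}f(p)$, $\mathsf{Contraquorum} f=\bigwedge_{O\in\mathcal O^{\neq\emptyset}}\bigvee_{p\in O}f(p)$. Logic: a model $\mu=(\mathrm{Val},(\mathcal P,\mathcal O),\varsigma)$ consists of a nonempty set $\mathrm{Val}$, a semitopology, and for each predicate symbol $R$ a function $\varsigma(R):\mathcal P\to\mathrm{Val}\to\mathbf 3$. Formulas are built from atoms $R(t)$, value equalities $v\doteq v'$ (denoting $\mathbf t$ if $v=v'$, else $\mathbf f$), connectives $\neg,\wedge,\vee,\to_w$, modalities $\mathsf T,\mathsf B,\mathsf{TF}$, operators $\mathsf{Everywhere},\mathsf{Somewhere},\mathsf{Quorum},\mathsf{Contraquorum}$ and quantifiers over $\mathrm{Val}$. Denotation $[\![\phi]\!]:\mathcal P\to\mathbf 3$: $[\![R(v)]\!](p)=\varsigma(R)(p)(v)$; connectives and modalities pointwise in $p$; $[\![\mathsf{Quorum}\,\phi]\!](p)=\mathsf{Quorum}([\![\phi]\!])$ for all $p$, likewise for the other three operators; $[\![\exists a.\phi]\!](p)=\bigvee_{v}[\![\phi[a:=v]]\!](p)$, $[\![\forall a.\phi]\!](p)=\bigwedge_{v}[\![\phi[a:=v]]\!](p)$; $[\![\exists_{01}a.\phi]\!](p)=\bigwedge_{v,v'}\big(([\![\phi[a:=v]]\!](p)\wedge[\![\phi[a:=v']]\!](p))\to_w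 (v\doteq v')\big)$; $\exists_1 a.\phi:=(\exists_{01}a.\phi)\wedge(\exists a.\phi)$. $p\models\phi$ iff $[\![\phi]\!](p)\in\{\mathbf t,\mathbf b\}$; $\models\phi$ iff $p\models\phi$ for all $p$. $\mathrm{correct}(R):=\forall a.\mathsf{TF}R(a)$, $\mathrm{incorrect}(R):=\forall a.\mathsf B R(a)$. Axioms with a free variable $a$ are universally quantified over $a$; an axiom is valid in $\mu$ if $\models$ it. $\mathrm{ThyBB}$ consists of: BrDeliver?: $\mathrm{deliver}(a)\to_w\mathsf{Quorum}\,\mathrm{ready}(a)$; BrReady?: $\mathrm{ready}(a)\to_w\mathsf{Quorum}\,\mathrm{echo}(a)$; BrEcho?: $\mathrm{echo}(a)\to_w\mathsf{Somewhere}\,\mathrm{broadcast}(a)$; BrEcho01: $\exists_{01}a.\mathrm{echo}(a)$; BrBroadcast1: $\exists_1 a.\mathsf{Somewhere}\,\mathrm{broadcast}(a)$; BrDeliver!: $\mathsf{Quorum}\,\mathrm{ready}(a)\to_w\mathrm{deliver}(a)$; BrReady!: $\mathsf{Quorum}\,\mathrm{echo}(a)\to_w\mathrm{ready}(a)$; BrEcho!: $\mathsf{Somewhere}\,\mathrm{broadcast}(a)\to_w\exists a.\mathrm{echo}(a)$; BrReady!!: $\mathsf{Contraquorum}\,\mathrm{ready}(a)\to_w\mathrm{ready}(a)$; BrCorrect: $\mathsf{Quorum}\,\mathrm{correct}(\mathrm{ready})\wedge\mathsf{Quorum}\,\mathrm{correct}(\mathrm{echo})$; BrCorrect': $\mathrm{correct}(R)\vee\mathrm{incorrect}(R)$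 for $R\in\{\mathrm{ready},\mathrm{echo}\}$; BrCorrect'': $\mathsf{Everywhere}\,\mathrm{correct}(\mathrm{broadcast})\vee\mathsf{Everywhere}\,\mathrm{incorrect}(\mathrm{broadcast})$. -}

module Defs where

open import Level using (Level; 0ℓ; Lift; lift; lower) renaming (suc to lsuc)
open import Data.Unit using (⊤)
open import Data.Product using (Σ; ∃; _×_; _,_; proj₁; proj₂)
open import Data.Sum using (_⊎_)
open import Relation.Nullary using (Dec; yes; no; ¬_)
open import Relation.Nullary.Decidable using (map′)
open import Relation.Binary.PropositionalEquality using (_≡_; _≢_)
open import Axiom.ExcludedMiddle using (ExcludedMiddle)

-- Classical metatheory: infima/suprema over arbitrary index sets in 3
-- are computed using excluded middle, which the theorem takes as a
-- hypothesis.

EM : Set₂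
EM = ExcludedMiddle (lsuc 0ℓ)

decide : EM → (A : Set) → Dec A
decide lem A = map′ lower lift (lem {Lift (lsuc 0ℓ) A})

-- Truth values 3 = {f < b < t}

data 𝟛 : Set where
  𝐟 𝐛 𝐭 : 𝟛

_∧₃_ : 𝟛 → 𝟛 → 𝟛
𝐟 ∧₃ y = 𝐟
𝐛 ∧₃ 𝐟 = 𝐟
𝐛 ∧₃ 𝐛 = 𝐛
𝐛 ∧₃ 𝐭 = 𝐛
𝐭 ∧₃ y = y

_∨₃_ : 𝟛 → 𝟛 → 𝟛
𝐟 ∨₃ y = y
𝐛 ∨₃ 𝐟 = 𝐛
𝐛 ∨₃ 𝐛 = 𝐛
𝐛 ∨₃ 𝐭 = 𝐭
𝐭 ∨₃ y = 𝐭

¬₃ : 𝟛 → 𝟛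
¬₃ 𝐭 = 𝐟
¬₃ 𝐛 = 𝐛
¬₃ 𝐟 = 𝐭

_→w_ : 𝟛 → 𝟛 → 𝟛
x →w y = ¬₃ x ∨₃ y

𝖳 : 𝟛 → 𝟛
𝖳 𝐭 = 𝐭
𝖳 𝐛 = 𝐟
𝖳 𝐟 = 𝐟

𝖡 : 𝟛 → 𝟛
𝖡 𝐭 = 𝐟
𝖡 𝐛 = 𝐭
𝖡 𝐟 = 𝐟

𝖳𝖥 : 𝟛 → 𝟛
𝖳𝖥 𝐭 = 𝐭
𝖳𝖥 𝐛 = 𝐟
𝖳𝖥 𝐟 = 𝐭

Valid : 𝟛 → Set
Valid x = x ≡ 𝐭 ⊎ x ≡ 𝐛

⋀ : EM → {I : Set₁} → (I → 𝟛) → 𝟛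
⋀ lem {I} g with lem {∀ i → g i ≡ 𝐭}
... | yes _ = 𝐭
... | no _ with lem {∀ i → g i ≢ 𝐟}
...   | yes _ = 𝐛
...   | no _ = 𝐟

⋁ : EM → {I : Set₁} → (I → 𝟛) → 𝟛
⋁ lem {I} g with lem {∃ λ i → g i ≡ 𝐭}
... | yes _ = 𝐭
... | no _ with lem {∃ λ i → g i ≡ 𝐛}
...   | yes _ = 𝐛
...   | no _ = 𝐟

⋀₀ : EM → {I : Set} → (I → 𝟛) → 𝟛
⋀₀ lem {I} g = ⋀ lem {Lift (lsuc 0ℓ) I} (λ i → g (lower i))

⋁₀ : EM → {I : Set} → (I → 𝟛) → 𝟛
⋁₀ lem {I} g = ⋁ lem {Lift (lsuc 0ℓ) I} (λ i → g (lower i))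

record Semitopology (P : Set) : Set₁ where
  field
    Open   : (P → Set) → Set
    full   : Open (λ _ → ⊤)
    unions : {I : Set} (U : I → P → Set) → (∀ i → Open (U i)) →
             Open (λ p → ∃ λ i → U i p)

open Semitopology public

NEOpen : {P : Set} → Semitopology P → Set₁
NEOpen {P} S = Σ (P → Set) λ U → Open S U × ∃ U

ThreeTwined : {P : Set} → Semitopology P → Set₁
ThreeTwined {P} S =
  (O₁ O₂ O₃ : NEOpen S) →
  ∃ λ p → proj₁ O₁ p × proj₁ O₂ p × proj₁ O₃ p

module _ (lem : EM) {P : Set} (S : Semitopology P) where

  Everywhere : (P → 𝟛) → 𝟛
  Everywhere f = ⋀₀ lem f

  Somewhere : (P → 𝟛) → 𝟛
  Somewhere f = ⋁₀ lem f

  Quorum : (P → 𝟛) → 𝟛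
  Quorum f = ⋁ lem (λ (O : NEOpen S) →
               ⋀₀ lem (λ (x : Σ P (proj₁ O)) → f (proj₁ x)))

  Contraquorum : (P → 𝟛) → 𝟛
  Contraquorum f = ⋀ lem (λ (O : NEOpen S) →
                     ⋁₀ lem (λ (x : Σ P (proj₁ O)) → f (proj₁ x)))

record Model : Set₁ where
  field
    Val       : Set
    val₀      : Val                 -- Val is nonempty
    Pt        : Set
    top       : Semitopology Pt
    broadcast : Pt → Val → 𝟛
    echo      : Pt → Val → 𝟛
    ready     : Pt → Val → 𝟛
    deliver   : Pt → Val → 𝟛

module Semantics (lem : EM) (μ : Model) where
  open Model μ

  Den : Set
  Den = Pt → 𝟛

  infix 2 ⊨_
  infixr 4 _→ᵈ_
  infixr 6 _∨ᵈ_
  infixr 7 _∧ᵈ_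

  ⊨_ : Den → Set
  ⊨ φ = ∀ p → Valid (φ p)

  Q CQ Ev Sw : Den → Den
  Q  φ _ = Quorum lem top φ
  CQ φ _ = Contraquorum lem top φ
  Ev φ _ = Everywhere lem top φ
  Sw φ _ = Somewhere lem top φ

  _≐_ : Val → Val → Den
  (v ≐ v') _ with decide lem (v ≡ v')
  ... | yes _ = 𝐭
  ... | no _ = 𝐟

  _∧ᵈ_ _∨ᵈ_ _→ᵈ_ : Den → Den → Den
  (φ ∧ᵈ ψ) p = φ p ∧₃ ψ p
  (φ ∨ᵈ ψ) p = φ p ∨₃ ψ p
  (φ →ᵈ ψ) p = φ p →w ψ p

  ∀ᵈ ∃ᵈ ∃₀₁ ∃₁ : (Val → Den) → Den
  ∀ᵈ φ p = ⋀₀ lem (λ v → φ v p)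
  ∃ᵈ φ p = ⋁₀ lem (λ v → φ v p)
  ∃₀₁ φ p = ⋀₀ lem (λ (vv : Val × Val) →
              ((φ (proj₁ vv) ∧ᵈ φ (proj₂ vv)) →ᵈ (proj₁ vv ≐ proj₂ vv)) p)
  ∃₁ φ = ∃₀₁ φ ∧ᵈ ∃ᵈ φ

  Broadcast Echo Ready Deliver : Val → Den
  Broadcast v p = broadcast p v
  Echo      v p = echo p v
  Ready     v p = ready p v
  Deliver   v p = deliver p v

  correct incorrect : (Val → Den) → Den
  correct   R = ∀ᵈ λ a p → 𝖳𝖥 (R a p)
  incorrect R = ∀ᵈ λ a p → 𝖡 (R a p)

  -- The theory ThyBB; axioms with free variable a are universally closed.
  record ThyBB : Set where
    field
      BrDeliver?   : ⊨ ∀ᵈ λ a → Deliver a →ᵈ Q (Ready a)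
      BrReady?     : ⊨ ∀ᵈ λ a → Ready a →ᵈ Q (Echo a)
      BrEcho?      : ⊨ ∀ᵈ λ a → Echo a →ᵈ Sw (Broadcast a)
      BrEcho01     : ⊨ ∃₀₁ Echo
      BrBroadcast1 : ⊨ ∃₁ λ a → Sw (Broadcast a)
      BrDeliver!   : ⊨ ∀ᵈ λ a → Q (Ready a) →ᵈ Deliver a
      BrReady!     : ⊨ ∀ᵈ λ a → Q (Echo a) →ᵈ Ready a
      BrEcho!      : ⊨ ∀ᵈ λ a → Sw (Broadcast a) →ᵈ ∃ᵈ Echo
      BrReady!!    : ⊨ ∀ᵈ λ a → CQ (Ready a) →ᵈ Ready a
      BrCorrect    : ⊨ Q (correct Ready) ∧ᵈ Q (correct Echo)
      BrCorrect'r  : ⊨ correct Ready ∨ᵈ incorrect Ready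
      BrCorrect'e  : ⊨ correct Echo ∨ᵈ incorrect Echo
      BrCorrect''  : ⊨ Ev (correct Broadcast) ∨ᵈ Ev (incorrect Broadcast)

-- Suppose deliver(v) is t at p but f at q. By BrDeliver? at p the ready(v) values avoid f on some
-- nonempty open O₁, and by BrCorrect they avoid b on some open O₂. 3-twinedness makes every
-- nonempty open meet O₁ ∩ O₂, where ready(v) is t, so Contraquorum ready(v) = t. BrReady!! then
-- makes ready(v) valid everywhere, hence t on O₂, so Quorum ready(v) = t, and BrDeliver! at q
-- contradicts deliver(v) = f there.
module Submission where

open import Defs
open import Level using (lift; lower)
open import Data.Product using (Σ; ∃; _×_; _,_; proj₁; proj₂)
open import Data.Sum using (inj₁; inj₂)
open import Data.Empty using (⊥; ⊥-elim)
open import Relation.Nullary using (yes; no)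
open import Relation.Binary.PropositionalEquality using (_≡_; _≢_; refl; sym; trans)

≢𝐟⇒Valid : ∀ {x} → x ≢ 𝐟 → Valid x
≢𝐟⇒Valid {𝐟} x≢𝐟 = ⊥-elim (x≢𝐟 refl)
≢𝐟⇒Valid {𝐛} _   = inj₂ refl
≢𝐟⇒Valid {𝐭} _   = inj₁ refl

Valid⇒≢𝐟 : ∀ {x} → Valid x → x ≢ 𝐟
Valid⇒≢𝐟 (inj₁ refl) ()
Valid⇒≢𝐟 (inj₂ refl) ()

Valid∧≢𝐛⇒≡𝐭 : ∀ {x} → Valid x → x ≢ 𝐛 → x ≡ 𝐭
Valid∧≢𝐛⇒≡𝐭 (inj₁ x≡𝐭) _   = x≡𝐭
Valid∧≢𝐛⇒≡𝐭 (inj₂ x≡𝐛) x≢𝐛 = ⊥-elim (x≢𝐛 x≡𝐛)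

Valid-∧ˡ : ∀ x y → Valid (x ∧₃ y) → Valid x
Valid-∧ˡ 𝐛 _ _ = inj₂ refl
Valid-∧ˡ 𝐭 _ _ = inj₁ refl
Valid-∧ˡ 𝐟 _ v = ⊥-elim (Valid⇒≢𝐟 v refl)

Valid-→w-𝐭 : ∀ {x y} → x ≡ 𝐭 → Valid (x →w y) → Valid y
Valid-→w-𝐭 refl v = v

→w-Valid : ∀ x y → (x ≡ 𝐭 → y ≡ 𝐟 → ⊥) → Valid (x →w y)
→w-Valid 𝐟 _ _ = inj₁ refl
→w-Valid 𝐛 𝐟 _ = inj₂ refl
→w-Valid 𝐛 𝐛 _ = inj₂ refl
→w-Valid 𝐛 𝐭 _ = inj₁ refl
→w-Valid 𝐭 𝐟 h = ⊥-elim (h refl refl)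
→w-Valid 𝐭 𝐛 _ = inj₂ refl
→w-Valid 𝐭 𝐭 _ = inj₁ refl

𝖳𝖥≢𝐟⇒≢𝐛 : ∀ {x} → 𝖳𝖥 x ≢ 𝐟 → x ≢ 𝐛
𝖳𝖥≢𝐟⇒≢𝐛 𝖳𝖥x≢𝐟 refl = 𝖳𝖥x≢𝐟 refl

module _ (lem : EM) {I : Set₁} (g : I → 𝟛) where

  ⋀-≡𝐭 : (∀ i → g i ≡ 𝐭) → ⋀ lem g ≡ 𝐭
  ⋀-≡𝐭 all𝐭 with lem {∀ i → g i ≡ 𝐭}
  ... | yes _    = refl
  ... | no ¬all𝐭 = ⊥-elim (¬all𝐭 all𝐭)

  ⋀-Valid⇒≢𝐟 : Valid (⋀ lem g) → ∀ i → g i ≢ 𝐟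
  ⋀-Valid⇒≢𝐟 v i with lem {∀ i → g i ≡ 𝐭}
  ... | yes all𝐭 = λ gi≡𝐟 → Valid⇒≢𝐟 (inj₁ refl) (trans (sym (all𝐭 i)) gi≡𝐟)
  ... | no _ with lem {∀ i → g i ≢ 𝐟}
  ...   | yes all≢𝐟 = all≢𝐟 i
  ...   | no _      = ⊥-elim (Valid⇒≢𝐟 v refl)

  ⋀-≡𝐟⇒∃ : ⋀ lem g ≡ 𝐟 → ∃ λ i → g i ≡ 𝐟
  ⋀-≡𝐟⇒∃ eq with lem {∀ i → g i ≡ 𝐭}
  ⋀-≡𝐟⇒∃ () | yes _
  ... | no _ with lem {∀ i → g i ≢ 𝐟}
  ⋀-≡𝐟⇒∃ () | no _ | yes _
  ...   | no ¬all≢𝐟 with lem {∃ λ i → g i ≡ 𝐟}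
  ...     | yes witness = witness
  ...     | no ¬∃𝐟      = ⊥-elim (¬all≢𝐟 λ i gi≡𝐟 → ¬∃𝐟 (i , gi≡𝐟))

  ⋁-≡𝐭 : ∀ i → g i ≡ 𝐭 → ⋁ lem g ≡ 𝐭
  ⋁-≡𝐭 i gi≡𝐭 with lem {∃ λ i → g i ≡ 𝐭}
  ... | yes _  = refl
  ... | no ¬∃𝐭 = ⊥-elim (¬∃𝐭 (i , gi≡𝐭))

  ⋁-≡𝐭⇒∃ : ⋁ lem g ≡ 𝐭 → ∃ λ i → g i ≡ 𝐭
  ⋁-≡𝐭⇒∃ eq with lem {∃ λ i → g i ≡ 𝐭}
  ... | yes witness = witness
  ... | no _ with lem {∃ λ i → g i ≡ 𝐛}
  ⋁-≡𝐭⇒∃ () | no _ | yes _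
  ⋁-≡𝐭⇒∃ () | no _ | no _

  ⋁-Valid⇒∃ : Valid (⋁ lem g) → ∃ λ i → Valid (g i)
  ⋁-Valid⇒∃ v with lem {∃ λ i → g i ≡ 𝐭}
  ... | yes (i , gi≡𝐭) = i , inj₁ gi≡𝐭
  ... | no _ with lem {∃ λ i → g i ≡ 𝐛}
  ...   | yes (i , gi≡𝐛) = i , inj₂ gi≡𝐛
  ...   | no _           = ⊥-elim (Valid⇒≢𝐟 v refl)

module _ (lem : EM) {I : Set} (g : I → 𝟛) where

  ⋀₀-≡𝐭 : (∀ i → g i ≡ 𝐭) → ⋀₀ lem g ≡ 𝐭
  ⋀₀-≡𝐭 all𝐭 = ⋀-≡𝐭 lem _ λ i → all𝐭 (lower i)

  ⋀₀-Valid⇒≢𝐟 : Valid (⋀₀ lem g) → ∀ i → g i ≢ 𝐟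
  ⋀₀-Valid⇒≢𝐟 v i = ⋀-Valid⇒≢𝐟 lem _ v (lift i)

  ⋀₀-≡𝐟⇒∃ : ⋀₀ lem g ≡ 𝐟 → ∃ λ i → g i ≡ 𝐟
  ⋀₀-≡𝐟⇒∃ eq with ⋀-≡𝐟⇒∃ lem _ eq
  ... | i , gi≡𝐟 = lower i , gi≡𝐟

  ⋁₀-≡𝐭 : ∀ i → g i ≡ 𝐭 → ⋁₀ lem g ≡ 𝐭
  ⋁₀-≡𝐭 i = ⋁-≡𝐭 lem _ (lift i)

  ⋁₀-≡𝐭⇒∃ : ⋁₀ lem g ≡ 𝐭 → ∃ λ i → g i ≡ 𝐭
  ⋁₀-≡𝐭⇒∃ eq with ⋁-≡𝐭⇒∃ lem _ eq
  ... | i , gi≡𝐭 = lower i , gi≡𝐭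

module _ (lem : EM) {P : Set} (S : Semitopology P) (f : P → 𝟛) where

  Quorum-Valid⇒∃ : Valid (Quorum lem S f) →
                   Σ (NEOpen S) λ O → ∀ x → proj₁ O x → f x ≢ 𝐟
  Quorum-Valid⇒∃ v with ⋁-Valid⇒∃ lem _ v
  ... | O , vO = O , λ x x∈O → ⋀₀-Valid⇒≢𝐟 lem _ vO (x , x∈O)

  Quorum-≡𝐭 : (O : NEOpen S) → (∀ x → proj₁ O x → f x ≡ 𝐭) → Quorum lem S f ≡ 𝐭
  Quorum-≡𝐭 O 𝐭-on-O = ⋁-≡𝐭 lem _ O (⋀₀-≡𝐭 lem _ λ (x , x∈O) → 𝐭-on-O x x∈O)

  Contraquorum-≡𝐭 : (∀ (O : NEOpen S) → ∃ λ x → proj₁ O x × f x ≡ 𝐭) →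
                    Contraquorum lem S f ≡ 𝐭
  Contraquorum-≡𝐭 meets = ⋀-≡𝐭 lem _ λ O →
    let (x , x∈O , fx≡𝐭) = meets O in ⋁₀-≡𝐭 lem _ (x , x∈O) fx≡𝐭

  ThreeTwined⇒Contraquorum-≡𝐭 : ThreeTwined S → (O₁ O₂ : NEOpen S) →
    (∀ x → proj₁ O₁ x → f x ≢ 𝐟) → (∀ x → proj₁ O₂ x → f x ≢ 𝐛) →
    Contraquorum lem S f ≡ 𝐭
  ThreeTwined⇒Contraquorum-≡𝐭 twined O₁ O₂ ≢𝐟-on-O₁ ≢𝐛-on-O₂ = Contraquorum-≡𝐭 λ O →
    let (x , x∈O , x∈O₁ , x∈O₂) = twined O O₁ O₂
    in x , x∈O , Valid∧≢𝐛⇒≡𝐭 (≢𝐟⇒Valid (≢𝐟-on-O₁ x x∈O₁)) (≢𝐛-on-O₂ x x∈O₂)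

module _ (lem : EM) (μ : Model) (thy : Semantics.ThyBB lem μ) where
  open Model μ
  open Semantics lem μ
  open ThyBB thy

  ⊨∀ᵈ⇒⊨ : {φ : Val → Den} → ⊨ ∀ᵈ φ → ∀ a → ⊨ φ a
  ⊨∀ᵈ⇒⊨ ⊨∀φ a p = ≢𝐟⇒Valid (⋀₀-Valid⇒≢𝐟 lem _ (⊨∀φ p) a)

  -- BrCorrect holds at every point, but its Quorum is constant, so any one point suffices.
  ready-correct-open : Pt → Σ (NEOpen top) λ O → ∀ x → proj₁ O x → ∀ a → ready x a ≢ 𝐛
  ready-correct-open p with Quorum-Valid⇒∃ lem top _ (Valid-∧ˡ _ _ (BrCorrect p))
  ... | O , correct-on-O =
    O , λ x x∈O a → 𝖳𝖥≢𝐟⇒≢𝐛 (⋀₀-Valid⇒≢𝐟 lem _ (≢𝐟⇒Valid (correct-on-O x x∈O)) a)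

  Quorum-ready-Valid⇒≡𝐭 : ThreeTwined top → ∀ a →
    Valid (Quorum lem top (Ready a)) → Quorum lem top (Ready a) ≡ 𝐭
  Quorum-ready-Valid⇒≡𝐭 twined a v = Quorum-≡𝐭 lem top _ O₂ ready-𝐭-on-O₂
    where
    O₁ : NEOpen top
    O₁ = proj₁ (Quorum-Valid⇒∃ lem top _ v)

    correct-open : Σ (NEOpen top) λ O → ∀ x → proj₁ O x → ∀ a → ready x a ≢ 𝐛
    correct-open = ready-correct-open (proj₁ (proj₂ (proj₂ O₁)))

    O₂ : NEOpen top
    O₂ = proj₁ correct-open

    ready≢𝐛-on-O₂ : ∀ x → proj₁ O₂ x → ready x a ≢ 𝐛
    ready≢𝐛-on-O₂ x x∈O₂ = proj₂ correct-open x x∈O₂ a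

    Contraquorum-ready≡𝐭 : Contraquorum lem top (Ready a) ≡ 𝐭
    Contraquorum-ready≡𝐭 = ThreeTwined⇒Contraquorum-≡𝐭 lem top _ twined O₁ O₂
      (proj₂ (Quorum-Valid⇒∃ lem top _ v)) ready≢𝐛-on-O₂

    ready-𝐭-on-O₂ : ∀ x → proj₁ O₂ x → ready x a ≡ 𝐭
    ready-𝐭-on-O₂ x x∈O₂ = Valid∧≢𝐛⇒≡𝐭
      (Valid-→w-𝐭 Contraquorum-ready≡𝐭 (⊨∀ᵈ⇒⊨ BrReady!! a x)) (ready≢𝐛-on-O₂ x x∈O₂)

  deliver-agreement : ThreeTwined top → ∀ a p q → deliver p a ≡ 𝐭 → deliver q a ≢ 𝐟
  deliver-agreement twined a p q deliver-p≡𝐭 =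
    Valid⇒≢𝐟 (Valid-→w-𝐭 Quorum-ready≡𝐭 (⊨∀ᵈ⇒⊨ BrDeliver! a q))
    where
    Quorum-ready≡𝐭 : Quorum lem top (Ready a) ≡ 𝐭
    Quorum-ready≡𝐭 = Quorum-ready-Valid⇒≡𝐭 twined a
      (Valid-→w-𝐭 deliver-p≡𝐭 (⊨∀ᵈ⇒⊨ BrDeliver? a p))

proposition4p19 : (lem : EM) (μ : Model) →
    ThreeTwined (Model.top μ) →
    Semantics.ThyBB lem μ →
    (v : Model.Val μ) →
    let open Semantics lem μ in
    ⊨ (Sw (Deliver v) →ᵈ Ev (Deliver v))
proposition4p19 lem μ twined thy v _ = →w-Valid _ _ λ somewhere≡𝐭 everywhere≡𝐟 →
  let (p , deliver-p≡𝐭) = ⋁₀-≡𝐭⇒∃ lem _ somewhere≡𝐭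
      (q , deliver-q≡𝐟) = ⋀₀-≡𝐟⇒∃ lem _ everywhere≡𝐟
  in deliver-agreement lem μ thy twined v p q deliver-p≡𝐭 deliver-q≡𝐟
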